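{- For every $\epsilon\in(0,1)$, the function $-\Phi^v_\epsilon(G)$ is robustly lift-monotone. Explicitly, for every $d$-regular graph $H$, every lift $L$ of $H$, and every $d$-regular $L'$ on $V(L)$ with $\Delta(L,L')\le\gamma$, we have $-\Phi^v_\epsilon(L')\ge-\Phi^v_\epsilon(H)-\delta_H(\gamma)$ for some $\delta_H$ with $\delta_H(\gamma)\to0$ as $\gamma\to0$.
   Context: Vertex boundary: $\partial_vS=\{u\in V(G):\{u,v\}\in E(G)\text{ for some }v\in S\}$. Small-set vertex expansion: for $G$ on $n$ vertices, $\Phi^v_\epsilon(G)=\min_{S\subseteq V(G),\,1\le|S|\le\epsilon n}|\partial_vS|/|S|$. Lifts: for a $d$-regular $H$ on $k$ vertices with adjacency matrix $M$, a graph $G$ on $km$ vertices is a lift of $H$ if there is a balanced partition $\sigma:V(G)\to[k]$ such that each fiber $\sigma^{ -1}(i)$ induces an $M_{ii}$-regular graph, and for $i\ne j$ the edges between fibers $i$ and $j$ form an $M_{ij}$-regular bipartite graph. Distance: $\Delta(G,G')=|E(G)\triangle E(G')|/(2n)$.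
   Formalization: The parameters ε and γ range over the rationals, and δ_H is taken as a function from ℚ to ℚ. -}

module Defs where

open import Data.Bool using (Bool; true; false; _∧_; if_then_else_)
open import Data.Nat as ℕ using (ℕ; zero; suc)
open import Data.Fin using (Fin; _≟_)
open import Data.List using (List; []; _∷_; foldr; map; allFin; concatMap)
open import Data.Nat.ListAction using (sum)
open import Data.Bool.ListAction using (any)
open import Data.Vec using (Vec; []; _∷_; lookup; tabulate)
open import Data.Fin.Subset using (Subset; inside; outside; ∣_∣)
open import Data.Maybe using (Maybe; just; nothing)
open import Data.Integer as ℤ using (+_)
open import Data.Rational as ℚ using (ℚ; _≤_; _<_; _/_; _⊓_; _+_; _*_)
open import Data.Rational.Properties using (_≤?_)
open import Data.Unit using (⊤)
open import Data.Empty using (⊥)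
open import Data.Product using (Σ; _×_)
open import Relation.Nullary using (yes; no; does)
open import Relation.Binary.PropositionalEquality using (_≡_)

ℕtoℚ : ℕ → ℚ
ℕtoℚ n = (+ n) / 1

-- a / b as a rational, with the (never used) convention a / 0 = 0
ratio : ℕ → ℕ → ℚ
ratio a zero    = ℚ.0ℚ
ratio a (suc b) = (+ a) / suc b

count : ∀ {n} → (Fin n → Bool) → ℕ
count {n} p = sum (map (λ v → if p v then 1 else 0) (allFin n))

Adj : ℕ → Set
Adj n = Fin n → Fin n → Bool

IsSimple : ∀ {n} → Adj n → Set
IsSimple {n} A = (∀ u v → A u v ≡ A v u) × (∀ u → A u u ≡ false)

degree : ∀ {n} → Adj n → Fin n → ℕ
degree A u = count (A u)

Regular : ∀ {n} → ℕ → Adj n → Set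
Regular {n} d A = ∀ u → degree A u ≡ d

-- The base graph H: a d-regular (multi)graph on k vertices, given by its
-- symmetric adjacency matrix M with nonnegative integer entries and all
-- row sums equal to d (a loop at i contributes M i i to the degree, matching
-- the lift convention that fibre i induces an M i i -regular graph).
IsRegularMatrix : ∀ {k} → ℕ → (Fin k → Fin k → ℕ) → Set
IsRegularMatrix {k} d M =
  (∀ i j → M i j ≡ M j i) × (∀ i → sum (map (M i) (allFin k)) ≡ d)

support : ∀ {k} → (Fin k → Fin k → ℕ) → Adj k
support M i j with M i j
... | zero  = false
... | suc _ = true

-- G on k * m vertices is a lift of H (matrix M) via σ : V(G) → Fin k:
--  * σ is balanced: every fibre has exactly m elements;
--  * every vertex u has exactly M (σ u) j neighbours in fibre j, for every j.
-- (For j = σ u this says fibre σ u induces an M_ii-regular graph; for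
-- j ≠ σ u, together with symmetry of G and of M, this says the edges
-- between fibres i and j form an M_ij-regular bipartite graph.)
IsLiftVia : ∀ {k} (M : Fin k → Fin k → ℕ) (m : ℕ) →
            Adj (k ℕ.* m) → (Fin (k ℕ.* m) → Fin k) → Set
IsLiftVia {k} M m G σ =
  IsSimple G ×
  ((i : Fin k) → count (λ u → does (σ u ≟ i)) ≡ m) ×
  ((u : Fin (k ℕ.* m)) (j : Fin k) →
     count (λ v → G u v ∧ does (σ v ≟ j)) ≡ M (σ u) j)

IsLift : ∀ {k} (M : Fin k → Fin k → ℕ) (m : ℕ) → Adj (k ℕ.* m) → Set
IsLift {k} M m G = Σ (Fin (k ℕ.* m) → Fin k) (IsLiftVia M m G)

allSubsets : ∀ n → List (Subset n)
allSubsets zero    = [] ∷ []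
allSubsets (suc n) = concatMap (λ s → (inside ∷ s) ∷ (outside ∷ s) ∷ []) (allSubsets n)

inS : ∀ {n} → Subset n → Fin n → Bool
inS S v with lookup S v
... | inside  = true
... | outside = false

boundary : ∀ {n} → Adj n → Subset n → Subset n
boundary {n} A S =
  tabulate (λ u → if any (λ v → A u v ∧ inS S v) (allFin n) then inside else outside)

-- minimum in ℚ ∪ {+∞}, with nothing = +∞
minM : Maybe ℚ → Maybe ℚ → Maybe ℚ
minM nothing  y        = y
minM (just x) nothing  = just x
minM (just x) (just y) = just (x ⊓ y)

admissible : ∀ {n} → ℚ → Subset n → Bool
admissible {n} ε S with ∣ S ∣
... | zero  = false
... | suc c = does (ℕtoℚ (suc c) ≤? (ε * ℕtoℚ n))

-- Φ^v_ε(G) = min over 1 ≤ |S| ≤ ε n of |∂_v S| / |S|;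
-- nothing (= +∞) when there is no admissible S (min over the empty set).
Φv : ∀ {n} → ℚ → Adj n → Maybe ℚ
Φv {n} ε A =
  foldr (λ S acc → if admissible ε S
                     then minM (just (ratio ∣ boundary A S ∣ ∣ S ∣)) acc
                     else acc)
        nothing (allSubsets n)

_≤∞_ : Maybe ℚ → Maybe ℚ → Set
x        ≤∞ nothing  = ⊤
nothing  ≤∞ just y   = ⊥
just x   ≤∞ just y   = x ≤ y

_+∞_ : Maybe ℚ → ℚ → Maybe ℚ
nothing +∞ q = nothing
just x  +∞ q = just (x + q)

-- Distance  Δ(G,G') = |E(G) △ E(G')| / (2n).
-- Counting ordered pairs (u,v) with differing adjacency counts every
-- edge of the symmetric difference twice, hence the factor 4n.
orderedDiff : ∀ {n} → Adj n → Adj n → ℕ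
orderedDiff {n} A B =
  sum (map (λ u → count (λ v → if A u v then (if B u v then false else true) else B u v))
           (allFin n))

dist : ∀ {n} → Adj n → Adj n → ℚ
dist {n} A B = ratio (orderedDiff A B) (4 ℕ.* n)

TendsToZero : (ℚ → ℚ) → Set
TendsToZero δ =
  ∀ (η : ℚ) → ℚ.0ℚ < η →
    Σ ℚ (λ θ → ℚ.0ℚ < θ ×
      (∀ (γ : ℚ) → ℚ.0ℚ < γ → γ < θ → ℚ.∣ δ γ ∣ ≤ η))

-- Pull back a set S ⊆ V(H) along the covering map σ : V(L) → V(H). The fibres have
-- size m, so |σ⁻¹S| = m|S| and σ⁻¹S is again admissible; every edge of L lies over an
-- edge of H, so ∂_L(σ⁻¹S) ⊆ σ⁻¹(∂S), which has size m|∂S|. Passing from L to L′ adds at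
-- most one boundary vertex per ordered pair on which the two graphs differ, and there
-- are 4km·Δ(L,L′) such pairs. Hence
--   Φ(L′) ≤ |∂S|/|S| + 4kmΔ/(m|S|) ≤ |∂S|/|S| + 4kΔ,
-- so δ_H(γ) = 4kγ works.
module Submission where

open import Defs
import Data.Nat
open import Data.Nat as ℕ using (ℕ; zero; suc; _+_; _*_; z≤n; s≤s; NonZero)
import Data.Nat.Properties as ℕ
open import Data.Nat.ListAction using () renaming (sum to sumₗ)
open import Data.Nat.Solver using (module +-*-Solver)
open import Algebra.Properties.Semiring.Sum ℕ.+-*-semiring
  using (sum-syntax; sum-cong-≗; sum-remove; sum-replicate-zero; ∑-distrib-+; ∑-comm; *-distribˡ-sum; *-distribʳ-sum)
open import Data.Bool using (Bool; true; false; T; _∧_; if_then_else_)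
open import Data.Bool.Properties using (T-∧; T-≡)
open import Data.Bool.ListAction using (any)
open import Data.Fin using (Fin; zero; suc; _≟_)
open import Data.Fin.Subset using (Subset; inside; outside; ∣_∣)
open import Data.Fin.Subset.Properties using (∣p∣≤n)
open import Data.List as List using (List; []; _∷_; foldr; map; allFin)
open import Data.List.Properties using (map-tabulate)
open import Data.List.Membership.Propositional using (_∈_; lose)
open import Data.List.Membership.Propositional.Properties using (∈-allFin; ∈-concatMap⁺)
open import Data.List.Relation.Unary.Any using (here; there; satisfied)
open import Data.List.Relation.Unary.Any.Properties using (any⁺; any⁻)
open import Data.Vec using (_∷_; []; lookup; tabulate)
open import Data.Vec.Properties using (lookup∘tabulate)
open import Data.Maybe using (Maybe; just; nothing)
open import Data.Integer as ℤ using (+≤+)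
import Data.Integer.Properties as ℤ
open import Data.Rational as ℚ using (ℚ; 0ℚ; 1ℚ; _<_; _≤_; toℚᵘ)
import Data.Rational.Properties as ℚ
open import Data.Rational.Unnormalised as ℚᵘ using (mkℚᵘ; *≤*)
import Data.Rational.Unnormalised.Properties as ℚᵘ
open import Algebra.Bundles using (CommutativeMonoid)
open import Algebra.Properties.CommutativeSemigroup
  (CommutativeMonoid.commutativeSemigroup ℚ.*-1-commutativeMonoid) using (x∙yz≈y∙xz)
open import Data.Product using (Σ; ∃-syntax; _×_; _,_)
open import Data.Sum using (_⊎_; inj₁; inj₂)
open import Function using (_∘_; id; Equivalence)
open import Relation.Nullary using (does)
open import Relation.Nullary.Decidable using (toWitness; fromWitness; isYes≗does; dec-true)
open import Relation.Binary.PropositionalEquality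

𝟙 : Bool → ℕ
𝟙 b = if b then 1 else 0

sumₗ-map-allFin : ∀ {n} (f : Fin n → ℕ) → sumₗ (map f (allFin n)) ≡ ∑[ i < n ] f i
sumₗ-map-allFin f = trans (cong sumₗ (map-tabulate id f)) (sumₗ-tabulate f)
  where
  sumₗ-tabulate : ∀ {n} (f : Fin n → ℕ) → sumₗ (List.tabulate f) ≡ ∑[ i < n ] f i
  sumₗ-tabulate {zero}  f = refl
  sumₗ-tabulate {suc n} f = cong (f zero +_) (sumₗ-tabulate (f ∘ suc))

count≡∑ : ∀ {n} (p : Fin n → Bool) → count p ≡ ∑[ v < n ] 𝟙 (p v)
count≡∑ p = sumₗ-map-allFin (𝟙 ∘ p)

∑-mono-≤ : ∀ {n} {f g : Fin n → ℕ} → (∀ i → f i ℕ.≤ g i) → ∑[ i < n ] f i ℕ.≤ ∑[ i < n ] g i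
∑-mono-≤ {zero}  f≤g = z≤n
∑-mono-≤ {suc n} f≤g = ℕ.+-mono-≤ (f≤g zero) (∑-mono-≤ (f≤g ∘ suc))

∑-≥-term : ∀ {n} (f : Fin n → ℕ) i → f i ℕ.≤ ∑[ j < n ] f j
∑-≥-term {suc n} f i = ℕ.≤-trans (ℕ.m≤m+n (f i) _) (ℕ.≤-reflexive (sym (sum-remove {i = i} f)))

∑-select : ∀ {k} (x : Fin k) (g : Fin k → ℕ) → ∑[ i < k ] (𝟙 (does (x ≟ i)) * g i) ≡ g x
∑-select {suc k} zero    g = trans (cong (g zero + 0 +_) (sum-replicate-zero k))
                                   (trans (ℕ.+-identityʳ _) (ℕ.+-identityʳ _))
∑-select {suc k} (suc x) g = ∑-select x (g ∘ suc)

count-pos : ∀ {n} (p : Fin n → Bool) v → T (p v) → 1 ℕ.≤ count p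
count-pos p v pv with p v in pv≡true
... | true = subst₂ ℕ._≤_ (cong 𝟙 pv≡true) (sym (count≡∑ p)) (∑-≥-term (𝟙 ∘ p) v)

𝟙-≤-+ : ∀ {a b c} → (T a → T b ⊎ 1 ℕ.≤ c) → 𝟙 a ℕ.≤ 𝟙 b + c
𝟙-≤-+ {false}        _  = z≤n
𝟙-≤-+ {true} {true}  _  = s≤s z≤n
𝟙-≤-+ {true} {false} a⇒ with a⇒ _
... | inj₂ 1≤c = 1≤c

∑-∘-balanced : ∀ {n k m} (σ : Fin n → Fin k) → (∀ i → count (λ u → does (σ u ≟ i)) ≡ m) →
               (f : Fin k → ℕ) → ∑[ u < n ] f (σ u) ≡ m * ∑[ i < k ] f i
∑-∘-balanced {n} {k} {m} σ balanced f = begin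
  ∑[ u < n ] f (σ u)                                 ≡⟨ sum-cong-≗ (λ u → ∑-select (σ u) f) ⟨
  ∑[ u < n ] ∑[ i < k ] (𝟙 (does (σ u ≟ i)) * f i)   ≡⟨ ∑-comm (λ u i → 𝟙 (does (σ u ≟ i)) * f i) ⟩
  ∑[ i < k ] ∑[ u < n ] (𝟙 (does (σ u ≟ i)) * f i)   ≡⟨ sum-cong-≗ (λ i → *-distribʳ-sum (f i) (λ u → 𝟙 (does (σ u ≟ i)))) ⟨
  ∑[ i < k ] (∑[ u < n ] 𝟙 (does (σ u ≟ i)) * f i)   ≡⟨ sum-cong-≗ (λ i → cong (_* f i) (fibre-size i)) ⟩
  ∑[ i < k ] (m * f i)                               ≡⟨ *-distribˡ-sum m f ⟨
  m * ∑[ i < k ] f i                                 ∎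
  where
  open ≡-Reasoning
  fibre-size : ∀ i → ∑[ u < n ] 𝟙 (does (σ u ≟ i)) ≡ m
  fibre-size i = trans (sym (count≡∑ (λ u → does (σ u ≟ i)))) (balanced i)

inS≡lookup : ∀ {n} (S : Subset n) v → inS S v ≡ lookup S v
inS≡lookup S v with lookup S v
... | true  = refl
... | false = refl

inS-tabulate : ∀ {n} (f : Fin n → Bool) u → inS (tabulate f) u ≡ f u
inS-tabulate f u = trans (inS≡lookup (tabulate f) u) (lookup∘tabulate f u)

∣S∣≡∑ : ∀ {n} (S : Subset n) → ∣ S ∣ ≡ ∑[ v < n ] 𝟙 (inS S v)
∣S∣≡∑ S = trans (∣S∣≡∑lookup S) (sum-cong-≗ (cong 𝟙 ∘ sym ∘ inS≡lookup S))
  where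
  ∣S∣≡∑lookup : ∀ {n} (S : Subset n) → ∣ S ∣ ≡ ∑[ v < n ] 𝟙 (lookup S v)
  ∣S∣≡∑lookup []            = refl
  ∣S∣≡∑lookup (inside  ∷ S) = cong suc (∣S∣≡∑lookup S)
  ∣S∣≡∑lookup (outside ∷ S) = ∣S∣≡∑lookup S

preimage : ∀ {n k} → (Fin n → Fin k) → Subset k → Subset n
preimage σ S = tabulate (inS S ∘ σ)

∣preimage∣ : ∀ {n k m} (σ : Fin n → Fin k) → (∀ i → count (λ u → does (σ u ≟ i)) ≡ m) →
             ∀ S → ∣ preimage σ S ∣ ≡ m * ∣ S ∣
∣preimage∣ {n} {k} {m} σ balanced S = begin
  ∣ preimage σ S ∣                        ≡⟨ ∣S∣≡∑ (preimage σ S) ⟩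
  ∑[ u < n ] 𝟙 (inS (preimage σ S) u)     ≡⟨ sum-cong-≗ (cong 𝟙 ∘ inS-tabulate (inS S ∘ σ)) ⟩
  ∑[ u < n ] 𝟙 (inS S (σ u))              ≡⟨ ∑-∘-balanced σ balanced (𝟙 ∘ inS S) ⟩
  m * ∑[ i < k ] 𝟙 (inS S i)              ≡⟨ cong (m *_) (∣S∣≡∑ S) ⟨
  m * ∣ S ∣                               ∎
  where open ≡-Reasoning

inS-boundary : ∀ {n} (A : Adj n) S u → inS (boundary A S) u ≡ any (λ v → A u v ∧ inS S v) (allFin n)
inS-boundary {n} A S u = trans (inS-tabulate _ u) (if-true-false (any (λ v → A u v ∧ inS S v) (allFin n)))
  where
  if-true-false : ∀ b → (if b then true else false) ≡ b
  if-true-false true  = refl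
  if-true-false false = refl

boundary⁻ : ∀ {n} (A : Adj n) S u → T (inS (boundary A S) u) → ∃[ v ] T (A u v) × T (inS S v)
boundary⁻ {n} A S u u∈∂S with satisfied (any⁻ _ (allFin n) (subst T (inS-boundary A S u) u∈∂S))
... | v , uv∈A∧v∈S = v , Equivalence.to T-∧ uv∈A∧v∈S

boundary⁺ : ∀ {n} (A : Adj n) S u v → T (A u v) → T (inS S v) → T (inS (boundary A S) u)
boundary⁺ A S u v uv∈A v∈S =
  subst T (sym (inS-boundary A S u)) (any⁺ _ (lose (∈-allFin v) (Equivalence.from T-∧ (uv∈A , v∈S))))

support⁺ : ∀ {k} (M : Fin k → Fin k → ℕ) i j → 1 ℕ.≤ M i j → T (support M i j)
support⁺ M i j 1≤Mij with M i j | 1≤Mij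
... | suc _ | _ = _

lift-edge⇒support : ∀ {k m} {M : Fin k → Fin k → ℕ} {L σ} → IsLiftVia M m L σ →
                    ∀ u v → T (L u v) → T (support M (σ u) (σ v))
lift-edge⇒support {M = M} {L} {σ} (_ , _ , neighbours) u v uv∈L =
  support⁺ M (σ u) (σ v) (subst (1 ℕ.≤_) (neighbours u (σ v))
    (count-pos (λ w → L u w ∧ does (σ w ≟ σ v)) v (Equivalence.from T-∧ (uv∈L , σv≟σv))))
  where
  σv≟σv : T (does (σ v ≟ σ v))
  σv≟σv = Equivalence.from T-≡ (dec-true (σ v ≟ σ v) refl)

differsAt : ∀ {n} → Adj n → Adj n → Fin n → Fin n → Bool
differsAt A B u v = if A u v then (if B u v then false else true) else B u v

differsAt-new-edge : ∀ {n} (A B : Adj n) u v → A u v ≡ false → T (B u v) → T (differsAt A B u v)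
differsAt-new-edge A B u v uv∉A uv∈B rewrite uv∉A = uv∈B

orderedDiff≡∑ : ∀ {n} (A B : Adj n) → orderedDiff A B ≡ ∑[ u < n ] count (differsAt A B u)
orderedDiff≡∑ A B = sumₗ-map-allFin (count ∘ differsAt A B)

boundary-preimage⊆ : ∀ {k m} {M : Fin k → Fin k → ℕ} {L σ} → IsLiftVia M m L σ →
  ∀ L′ S u → T (inS (boundary L′ (preimage σ S)) u) →
  T (inS (boundary (support M) S) (σ u)) ⊎ 1 ℕ.≤ count (differsAt L L′ u)
boundary-preimage⊆ {M = M} {L} {σ} lift L′ S u u∈∂S′ with boundary⁻ L′ (preimage σ S) u u∈∂S′
... | v , uv∈L′ , v∈S′ with L u v in uv∈L
...   | true  = inj₁ (boundary⁺ (support M) S (σ u) (σ v)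
                        (lift-edge⇒support {M = M} {L} {σ} lift u v (Equivalence.from T-≡ uv∈L))
                        (subst T (inS-tabulate (inS S ∘ σ) v) v∈S′))
...   | false = inj₂ (count-pos (differsAt L L′ u) v (differsAt-new-edge L L′ u v uv∈L uv∈L′))

boundary-preimage-≤ : ∀ {k m} {M : Fin k → Fin k → ℕ} {L σ} → IsLiftVia M m L σ →
  ∀ L′ S → ∣ boundary L′ (preimage σ S) ∣ ℕ.≤ m * ∣ boundary (support M) S ∣ + orderedDiff L L′
boundary-preimage-≤ {k} {m} {M} {L} {σ} lift@(_ , balanced , _) L′ S = begin
  ∣ boundary L′ (preimage σ S) ∣
    ≡⟨ ∣S∣≡∑ (boundary L′ (preimage σ S)) ⟩
  ∑[ u < k * m ] 𝟙 (inS (boundary L′ (preimage σ S)) u)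
    ≤⟨ ∑-mono-≤ (λ u → 𝟙-≤-+ (boundary-preimage⊆ lift L′ S u)) ⟩
  ∑[ u < k * m ] (𝟙 (inS ∂S (σ u)) + count (differsAt L L′ u))
    ≡⟨ ∑-distrib-+ (𝟙 ∘ inS ∂S ∘ σ) (count ∘ differsAt L L′) ⟩
  ∑[ u < k * m ] 𝟙 (inS ∂S (σ u)) + ∑[ u < k * m ] count (differsAt L L′ u)
    ≡⟨ cong₂ _+_ (trans (∑-∘-balanced σ balanced (𝟙 ∘ inS ∂S)) (cong (m *_) (sym (∣S∣≡∑ ∂S))))
                 (sym (orderedDiff≡∑ L L′)) ⟩
  m * ∣ ∂S ∣ + orderedDiff L L′
    ∎
  where
  open ℕ.≤-Reasoning
  ∂S = boundary (support M) S

toℚᵘ-ratio : ∀ a b → toℚᵘ (ratio a (suc b)) ℚᵘ.≃ mkℚᵘ (ℤ.+ a) b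
toℚᵘ-ratio a b = ℚ.toℚᵘ-fromℚᵘ (mkℚᵘ (ℤ.+ a) b)

ratio-≤ : ∀ a b c d → .{{_ : NonZero b}} → .{{_ : NonZero d}} → a * d ℕ.≤ c * b → ratio a b ≤ ratio c d
ratio-≤ a (suc b) c (suc d) ad≤cb = ℚ.toℚᵘ-cancel-≤
  (ℚᵘ.≤-respˡ-≃ (ℚᵘ.≃-sym (toℚᵘ-ratio a b)) (ℚᵘ.≤-respʳ-≃ (ℚᵘ.≃-sym (toℚᵘ-ratio c d))
    (*≤* (subst₂ ℤ._≤_ (ℤ.pos-* a (suc d)) (ℤ.pos-* c (suc b)) (+≤+ ad≤cb)))))

ratio-+ : ∀ a b c d → .{{_ : NonZero b}} → .{{_ : NonZero d}} →
          ratio a b ℚ.+ ratio c d ≡ ratio (a * d + c * b) (b * d)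
ratio-+ a (suc b) c (suc d) = ℚ.toℚᵘ-injective (begin
  toℚᵘ (ratio a (suc b) ℚ.+ ratio c (suc d))           ≈⟨ ℚ.toℚᵘ-homo-+ (ratio a (suc b)) (ratio c (suc d)) ⟩
  toℚᵘ (ratio a (suc b)) ℚᵘ.+ toℚᵘ (ratio c (suc d))   ≈⟨ ℚᵘ.+-cong (toℚᵘ-ratio a b) (toℚᵘ-ratio c d) ⟩
  mkℚᵘ (ℤ.+ a ℤ.* ℤ.+ suc d ℤ.+ ℤ.+ c ℤ.* ℤ.+ suc b) (d + b * suc d) ≡⟨ cong (λ z → mkℚᵘ z (d + b * suc d)) numerator ⟨
  mkℚᵘ (ℤ.+ (a * suc d + c * suc b)) (d + b * suc d)  ≈⟨ ℚᵘ.≃-sym (toℚᵘ-ratio (a * suc d + c * suc b) (d + b * suc d)) ⟩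
  toℚᵘ (ratio (a * suc d + c * suc b) (suc b * suc d)) ∎)
  where
  open ℚᵘ.≃-Reasoning
  numerator : ℤ.+ (a * suc d + c * suc b) ≡ ℤ.+ a ℤ.* ℤ.+ suc d ℤ.+ ℤ.+ c ℤ.* ℤ.+ suc b
  numerator = trans (ℤ.pos-+ (a * suc d) (c * suc b)) (cong₂ ℤ._+_ (ℤ.pos-* a (suc d)) (ℤ.pos-* c (suc b)))

ℕtoℚ-*-ratio : ∀ a c d → .{{_ : NonZero d}} → ℕtoℚ a ℚ.* ratio c d ≡ ratio (a * c) d
ℕtoℚ-*-ratio a c (suc d) = ℚ.toℚᵘ-injective (begin
  toℚᵘ (ℕtoℚ a ℚ.* ratio c (suc d))         ≈⟨ ℚ.toℚᵘ-homo-* (ℕtoℚ a) (ratio c (suc d)) ⟩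
  toℚᵘ (ℕtoℚ a) ℚᵘ.* toℚᵘ (ratio c (suc d)) ≈⟨ ℚᵘ.*-cong (toℚᵘ-ratio a 0) (toℚᵘ-ratio c d) ⟩
  mkℚᵘ (ℤ.+ a ℤ.* ℤ.+ c) (d + 0 * suc d)    ≡⟨ cong₂ mkℚᵘ (sym (ℤ.pos-* a c)) (ℕ.+-identityʳ d) ⟩
  mkℚᵘ (ℤ.+ (a * c)) d                      ≈⟨ ℚᵘ.≃-sym (toℚᵘ-ratio (a * c) d) ⟩
  toℚᵘ (ratio (a * c) (suc d))              ∎)
  where open ℚᵘ.≃-Reasoning

ℕtoℚ-* : ∀ a b → ℕtoℚ (a * b) ≡ ℕtoℚ a ℚ.* ℕtoℚ b
ℕtoℚ-* a b = sym (ℕtoℚ-*-ratio a b 1)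

ℕtoℚ-nonNeg : ∀ a → ℚ.NonNegative (ℕtoℚ a)
ℕtoℚ-nonNeg a = ℚ.normalize-nonNeg a 1

-- The cross-multiplied form of  b′/(mc) ≤ b/c + 4k·D/(4km).
lift-cross-bound : ∀ k m c b b′ D → b′ ℕ.≤ m * b + D → 1 ℕ.≤ c →
  b′ * (c * (4 * (k * m))) ℕ.≤ (b * (4 * (k * m)) + 4 * k * D * c) * (m * c)
lift-cross-bound k m c b b′ D b′≤mb+D 1≤c = begin
  b′ * (c * (4 * (k * m)))                        ≤⟨ ℕ.*-monoˡ-≤ (c * (4 * (k * m))) b′≤mb+D ⟩
  (m * b + D) * (c * (4 * (k * m)))               ≡⟨ expand k m c b D ⟩
  4 * k * m * (m * b * c) + 4 * k * m * c * D     ≤⟨ ℕ.+-monoʳ-≤ _ (ℕ.m≤m*n (4 * k * m * c * D) c {{ℕ.>-nonZero 1≤c}}) ⟩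
  4 * k * m * (m * b * c) + 4 * k * m * c * D * c ≡⟨ collect k m c b D ⟩
  (b * (4 * (k * m)) + 4 * k * D * c) * (m * c)   ∎
  where
  open ℕ.≤-Reasoning
  open +-*-Solver
  expand = solve 5 (λ k m c b D → (m :* b :+ D) :* (c :* (con 4 :* (k :* m)))
                   := con 4 :* k :* m :* (m :* b :* c) :+ con 4 :* k :* m :* c :* D) refl
  collect = solve 5 (λ k m c b D → con 4 :* k :* m :* (m :* b :* c) :+ con 4 :* k :* m :* c :* D :* c
                    := (b :* (con 4 :* (k :* m)) :+ con 4 :* k :* D :* c) :* (m :* c)) refl

ratio-lift-bound : ∀ k m c b b′ D γ → .{{_ : NonZero k}} → .{{_ : NonZero m}} → .{{_ : NonZero c}} →
  b′ ℕ.≤ m * b + D → ratio D (4 * (k * m)) ≤ γ → ratio b′ (m * c) ≤ ratio b c ℚ.+ ℕtoℚ (4 * k) ℚ.* γ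
ratio-lift-bound k@(suc _) m@(suc _) c@(suc _) b b′ D γ b′≤mb+D D≤γ = begin
  ratio b′ (m * c)
    ≤⟨ ratio-≤ b′ (m * c) (b * N + 4 * k * D * c) (c * N) (lift-cross-bound k m c b b′ D b′≤mb+D (s≤s z≤n)) ⟩
  ratio (b * N + 4 * k * D * c) (c * N)     ≡⟨ ratio-+ b c (4 * k * D) N ⟨
  ratio b c ℚ.+ ratio (4 * k * D) N         ≡⟨ cong (ratio b c ℚ.+_) (ℕtoℚ-*-ratio (4 * k) D N) ⟨
  ratio b c ℚ.+ ℕtoℚ (4 * k) ℚ.* ratio D N  ≤⟨ ℚ.+-monoʳ-≤ (ratio b c) (ℚ.*-monoˡ-≤-nonNeg (ℕtoℚ (4 * k)) {{ℕtoℚ-nonNeg (4 * k)}} D≤γ) ⟩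
  ratio b c ℚ.+ ℕtoℚ (4 * k) ℚ.* γ          ∎
  where
  open ℚ.≤-Reasoning
  N = 4 * (k * m)

n*1/[1+n]≤1 : ∀ n → ℕtoℚ n ℚ.* ratio 1 (suc n) ≤ 1ℚ
n*1/[1+n]≤1 n = begin
  ℕtoℚ n ℚ.* ratio 1 (suc n) ≡⟨ ℕtoℚ-*-ratio n 1 (suc n) ⟩
  ratio (n * 1) (suc n)      ≤⟨ ratio-≤ (n * 1) (suc n) 1 1 (subst₂ ℕ._≤_ n≡n*1*1 (sym (ℕ.*-identityˡ (suc n))) (ℕ.n≤1+n n)) ⟩
  1ℚ                         ∎
  where
  open ℚ.≤-Reasoning
  n≡n*1*1 : n ≡ n * 1 * 1
  n≡n*1*1 = sym (trans (ℕ.*-identityʳ (n * 1)) (ℕ.*-identityʳ n))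

ℕtoℚ-*-tendsToZero : ∀ K → TendsToZero (ℕtoℚ K ℚ.*_)
ℕtoℚ-*-tendsToZero K η 0<η = θ , 0<θ , bound
  where
  r = ratio 1 (suc K)
  θ = η ℚ.* r
  instance
    _ = ℚ.positive 0<η
    _ = ℚ.pos⇒nonNeg η
    _ = ℕtoℚ-nonNeg K
  0<θ : 0ℚ < θ
  0<θ = ℚ.positive⁻¹ θ {{ℚ.pos*pos⇒pos η r {{ℚ.normalize-pos 1 (suc K)}}}}
  bound : ∀ γ → 0ℚ < γ → γ < θ → ℚ.∣ ℕtoℚ K ℚ.* γ ∣ ≤ η
  bound γ 0<γ γ<θ = begin
    ℚ.∣ ℕtoℚ K ℚ.* γ ∣   ≡⟨ ℚ.0≤p⇒∣p∣≡p (ℚ.nonNegative⁻¹ (ℕtoℚ K ℚ.* γ) {{ℚ.nonNeg*nonNeg⇒nonNeg (ℕtoℚ K) γ}}) ⟩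
    ℕtoℚ K ℚ.* γ         ≤⟨ ℚ.*-monoˡ-≤-nonNeg (ℕtoℚ K) (ℚ.<⇒≤ γ<θ) ⟩
    ℕtoℚ K ℚ.* (η ℚ.* r) ≡⟨ x∙yz≈y∙xz (ℕtoℚ K) η r ⟩
    η ℚ.* (ℕtoℚ K ℚ.* r) ≤⟨ ℚ.*-monoˡ-≤-nonNeg η (n*1/[1+n]≤1 K) ⟩
    η ℚ.* 1ℚ             ≡⟨ ℚ.*-identityʳ η ⟩
    η                    ∎
    where
    open ℚ.≤-Reasoning
    instance _ = ℚ.pos⇒nonNeg γ {{ℚ.positive 0<γ}}

minOver : {X : Set} → (X → Bool) → (X → ℚ) → List X → Maybe ℚ
minOver adm r = foldr (λ x acc → if adm x then minM (just (r x)) acc else acc) nothing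

≤∞-trans-≤ : ∀ {y a b} → y ≤∞ just a → a ≤ b → y ≤∞ just b
≤∞-trans-≤ {just q} q≤a a≤b = ℚ.≤-trans q≤a a≤b

minM-≤ˡ : ∀ a z → minM (just a) z ≤∞ just a
minM-≤ˡ a nothing  = ℚ.≤-refl
minM-≤ˡ a (just b) = ℚ.p⊓q≤p a b

minM-≤ʳ : ∀ a {z b} → z ≤∞ just b → minM (just a) z ≤∞ just b
minM-≤ʳ a {just c} c≤b = ℚ.≤-trans (ℚ.p⊓q≤q a c) c≤b

minM-+∞-glb : ∀ {y a} z c → y ≤∞ just (a ℚ.+ c) → y ≤∞ (z +∞ c) → y ≤∞ (minM (just a) z +∞ c)
minM-+∞-glb nothing c y≤a+c _ = y≤a+c
minM-+∞-glb {just q} {a} (just b) c q≤a+c q≤b+c =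
  subst (q ≤_) (sym (ℚ.mono-≤-distrib-⊓ (ℚ.+-monoˡ-≤ c) a b)) (ℚ.⊓-glb q≤a+c q≤b+c)

module _ {X : Set} (adm : X → Bool) (r : X → ℚ) where

  minOver-≤ : ∀ {x xs} → x ∈ xs → T (adm x) → minOver adm r xs ≤∞ just (r x)
  minOver-≤ {x} {_ ∷ xs} (here refl) adm-x with adm x
  ... | true = minM-≤ˡ (r x) (minOver adm r xs)
  minOver-≤ {xs = y ∷ _} (there x∈xs) adm-x with adm y
  ... | true  = minM-≤ʳ (r y) (minOver-≤ x∈xs adm-x)
  ... | false = minOver-≤ x∈xs adm-x

  ≤∞-minOver-+∞ : ∀ {y} xs c → (∀ {x} → x ∈ xs → T (adm x) → y ≤∞ just (r x ℚ.+ c)) →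
                  y ≤∞ (minOver adm r xs +∞ c)
  ≤∞-minOver-+∞ []       c bound = _
  ≤∞-minOver-+∞ (x ∷ xs) c bound with adm x | bound (here refl)
  ... | true  | y≤rx+c = minM-+∞-glb (minOver adm r xs) c (y≤rx+c _) (≤∞-minOver-+∞ xs c (bound ∘ there))
  ... | false | _      = ≤∞-minOver-+∞ xs c (bound ∘ there)

∈-allSubsets : ∀ {n} (S : Subset n) → S ∈ allSubsets n
∈-allSubsets []            = here refl
∈-allSubsets (inside  ∷ S) = ∈-concatMap⁺ _ (lose (∈-allSubsets S) (here refl))
∈-allSubsets (outside ∷ S) = ∈-concatMap⁺ _ (lose (∈-allSubsets S) (there (here refl)))

Φv-≤ : ∀ {n} ε (A : Adj n) S → T (admissible ε S) → Φv ε A ≤∞ just (ratio (∣ boundary A S ∣) (∣ S ∣))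
Φv-≤ ε A S = minOver-≤ (admissible ε) (λ S → ratio (∣ boundary A S ∣) (∣ S ∣)) (∈-allSubsets S)

≤∞-Φv-+∞ : ∀ {n y} ε (A : Adj n) c →
  (∀ S → T (admissible ε S) → y ≤∞ just (ratio (∣ boundary A S ∣) (∣ S ∣) ℚ.+ c)) → y ≤∞ (Φv ε A +∞ c)
≤∞-Φv-+∞ {n} ε A c bound =
  ≤∞-minOver-+∞ (admissible ε) (λ S → ratio (∣ boundary A S ∣) (∣ S ∣)) (allSubsets n) c (λ {S} _ → bound S)

admissible⇒ : ∀ {n} ε (S : Subset n) → T (admissible ε S) → 1 ℕ.≤ ∣ S ∣ × ℕtoℚ ∣ S ∣ ≤ ε ℚ.* ℕtoℚ n
admissible⇒ {n} ε S adm with ∣ S ∣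
... | suc c = s≤s z≤n , toWitness (subst T (sym (isYes≗does (ℕtoℚ (suc c) ℚ.≤? ε ℚ.* ℕtoℚ n))) adm)

admissible⇐ : ∀ {n} ε (S : Subset n) → 1 ℕ.≤ ∣ S ∣ → ℕtoℚ ∣ S ∣ ≤ ε ℚ.* ℕtoℚ n → T (admissible ε S)
admissible⇐ {n} ε S 1≤∣S∣ ∣S∣≤εn with ∣ S ∣ | 1≤∣S∣
... | suc c | _ = subst T (isYes≗does (ℕtoℚ (suc c) ℚ.≤? ε ℚ.* ℕtoℚ n)) (fromWitness ∣S∣≤εn)

admissible-preimage : ∀ {k m} ε (σ : Fin (k * m) → Fin k) → (∀ i → count (λ u → does (σ u ≟ i)) ≡ m) →
  1 ℕ.≤ m → ∀ S → T (admissible ε S) → T (admissible ε (preimage σ S))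
admissible-preimage {k} {m} ε σ balanced 1≤m S adm
  with admissible⇒ ε S adm | ∣preimage∣ σ balanced S
... | 1≤∣S∣ , ∣S∣≤εk | ∣S′∣≡m∣S∣ = admissible⇐ ε (preimage σ S)
  (subst (1 ℕ.≤_) (sym ∣S′∣≡m∣S∣) (ℕ.*-mono-≤ 1≤m 1≤∣S∣))
  (subst (λ s → ℕtoℚ s ≤ ε ℚ.* ℕtoℚ (k * m)) (sym ∣S′∣≡m∣S∣) (begin
    ℕtoℚ (m * ∣ S ∣)                 ≡⟨ trans (ℕtoℚ-* m ∣ S ∣) (ℚ.*-comm (ℕtoℚ m) (ℕtoℚ ∣ S ∣)) ⟩
    ℕtoℚ ∣ S ∣ ℚ.* ℕtoℚ m            ≤⟨ ℚ.*-monoʳ-≤-nonNeg (ℕtoℚ m) {{ℕtoℚ-nonNeg m}} ∣S∣≤εk ⟩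
    ε ℚ.* ℕtoℚ k ℚ.* ℕtoℚ m          ≡⟨ ℚ.*-assoc ε (ℕtoℚ k) (ℕtoℚ m) ⟩
    ε ℚ.* (ℕtoℚ k ℚ.* ℕtoℚ m)        ≡⟨ cong (ε ℚ.*_) (ℕtoℚ-* k m) ⟨
    ε ℚ.* ℕtoℚ (k * m)               ∎))
  where open ℚ.≤-Reasoning

expansion-preimage-≤ : ∀ {k m} {M : Fin k → Fin k → ℕ} {L σ} ε → IsLiftVia M m L σ → 1 ℕ.≤ m →
  ∀ L′ γ → dist L L′ ≤ γ → ∀ S → T (admissible ε S) →
  ratio (∣ boundary L′ (preimage σ S) ∣) (∣ preimage σ S ∣)
    ≤ ratio (∣ boundary (support M) S ∣) (∣ S ∣) ℚ.+ ℕtoℚ (4 * k) ℚ.* γ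
expansion-preimage-≤ {k} {m} {M} {L} {σ} ε lift@(_ , balanced , _) 1≤m L′ γ dist≤γ S adm
  rewrite ∣preimage∣ σ balanced S with admissible⇒ ε S adm
... | 1≤∣S∣ , _ =
  ratio-lift-bound k m (∣ S ∣) (∣ boundary (support M) S ∣) (∣ boundary L′ (preimage σ S) ∣) (orderedDiff L L′) γ
    {{ℕ.>-nonZero (ℕ.≤-trans 1≤∣S∣ (∣p∣≤n S))}} {{ℕ.>-nonZero 1≤m}} {{ℕ.>-nonZero 1≤∣S∣}}
    (boundary-preimage-≤ lift L′ S) dist≤γ

proposition4p14 :
    (ε : ℚ) → 0ℚ < ε → ε < 1ℚ →
    (d k : ℕ) (M : Fin k → Fin k → ℕ) → IsRegularMatrix d M →
    Σ (ℚ → ℚ) (λ δ → TendsToZero δ ×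
      ((m : ℕ) → 1 Data.Nat.≤ m →
       (L L′ : Adj (k * m)) → IsLift M m L →
       IsSimple L′ → Regular d L′ →
       (γ : ℚ) → dist L L′ ≤ γ →
       Φv ε L′ ≤∞ (Φv ε (support M) +∞ δ γ)))
proposition4p14 ε _ _ _ k M _ = ℕtoℚ (4 * k) ℚ.*_ , ℕtoℚ-*-tendsToZero (4 * k) ,
  λ { m 1≤m L L′ (σ , lift@(_ , balanced , _)) _ _ γ dist≤γ →
      ≤∞-Φv-+∞ ε (support M) (ℕtoℚ (4 * k) ℚ.* γ) λ S adm →
        ≤∞-trans-≤ (Φv-≤ ε L′ (preimage σ S) (admissible-preimage ε σ balanced 1≤m S adm))
                   (expansion-preimage-≤ ε lift 1≤m L′ γ dist≤γ S adm) }
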